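{- Let $Z=\langle C,\mathcal{N}_{\mathsf{E}},\mathcal{N}_{\mathsf{C}}\rangle$ be a (bimodal) Kripke frame and $\mathsf{Alg}(Z)$ its complex modal algebra. If every formula of $\mathbf{QCKL}^{ - }$ is valid in $Z$, then: (1) $\mathsf{C}X=\bigcap_{n\in\omega}\mathsf{E}^nX$ for every $X\subseteq C$; (2) the formula $\mathsf{C}p\supset\mathsf{E}\mathsf{C}p$ is valid in $Z$.
   Context: Language: countable set of variables, $\top,\bot,\land,\neg,\forall$, countably many predicate symbols of each arity, two modal operators $\mathsf{E},\mathsf{C}$. $\mathbf{QCKL}^{ - }$ is the set of formulas derivable from: all classical predicate tautologies; $\Box(p\supset q)\supset(\Box p\supset\Box q)$ for $\Box\in\{\mathsf{E},\mathsf{C}\}$; $\mathsf{C}p\supset\mathsf{E}^np$ for each $n\in\omega$; modus ponens; uniform substitution; necessitation for $\mathsf{E}$ and $\mathsf{C}$; generalization; and the $\omega$-rule: from $\gamma\supset\mathsf{E}^n\phi$ for all $n\in\omega$ infer $\gamma\supset\mathsf{C}\phi$. A bimodal neighborhood frame is $\langle C,\mathcal{N}_{\mathsf{E}},\mathcal{N}_{\mathsf{C}}\rangle$ with $C\ne\emptyset$ and $\mathcal{N}_{\mathsf{E}},\mathcal{N}_{\mathsf{C}}\colon C\to\mathcal{P}(\mathcal{P}(C))$; it is a Kripke frame if for each $\mathcal{N}\in\{\mathcal{N}_{\mathsf{E}},\mathcal{N}_{\mathsf{C}}\}$ and each $c\in C$, $\mathcal{N}(c)$ is upward closed under inclusion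 and $\bigcap\mathcal{N}(c)\in\mathcal{N}(c)$. $\mathsf{Alg}(Z)$ is the power set Boolean algebra of $C$ with $\mathsf{E}X=\{c\mid X\in\mathcal{N}_{\mathsf{E}}(c)\}$, $\mathsf{C}X=\{c\mid X\in\mathcal{N}_{\mathsf{C}}(c)\}$. A formula is valid in $Z$ if for every nonempty (constant) domain $\mathcal{D}$, interpretation $\mathcal{I}$ ($P^{\mathcal{I}}(c)\subseteq\mathcal{D}^n$) and assignment $\mathcal{A}$ its valuation equals $C$, where valuation is: atomic via $\mathcal{I}$ pointwise, $\top\mapsto C$, $\bot\mapsto\emptyset$, Boolean connectives set-theoretically, $\forall x\phi\mapsto\bigcap_{d\in\mathcal{D}}v_{[d/x]\mathcal{A}}(\phi)$, $\mathsf{E}\phi\mapsto\mathsf{E}v(\phi)$, $\mathsf{C}\phi\mapsto\mathsf{C}v(\phi)$. -}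

module Defs where

open import Level using (Level; _⊔_) renaming (suc to lsuc; zero to lzero)
open import Data.Nat using (ℕ; zero; suc; _≟_)
open import Data.Bool using (Bool; true; false; _∧_; _∨_; not; if_then_else_; T)
open import Data.Vec using (Vec; map)
open import Data.Unit using (⊤)
open import Data.Empty using (⊥)
open import Data.Product using (Σ; _×_)
open import Relation.Nullary using (¬_; yes; no)
open import Relation.Nullary.Decidable using (⌊_⌋)

-- Syntax
-- Variables are natural numbers; the predicate symbol P^n_i (arity n,
-- index i) applied to variables x₁ … xₙ is  atom n i (x₁ ∷ … ∷ xₙ ∷ []).

data Fm : Set where
  atom : (n i : ℕ) → Vec ℕ n → Fm
  `⊤   : Fm
  `⊥   : Fm
  _`∧_ : Fm → Fm → Fm
  `¬_  : Fm → Fm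
  `∀   : ℕ → Fm → Fm
  `E   : Fm → Fm
  `C   : Fm → Fm

infixr 6 _`∧_
infixr 4 _`⊃_

_`⊃_ : Fm → Fm → Fm
φ `⊃ ψ = `¬ (φ `∧ `¬ ψ)

`Eⁿ : ℕ → Fm → Fm
`Eⁿ zero    φ = φ
`Eⁿ (suc n) φ = `E (`Eⁿ n φ)

`p : Fm
`p = atom 0 0 Data.Vec.[]

_==_ : ℕ → ℕ → Bool
m == n = ⌊ m ≟ n ⌋

anyVec : ∀ {n} → (ℕ → Bool) → Vec ℕ n → Bool
anyVec f Data.Vec.[] = false
anyVec f (x Data.Vec.∷ xs) = f x ∨ anyVec f xs

free : ℕ → Fm → Bool
free x (atom n i xs) = anyVec (_== x) xs
free x `⊤ = false
free x `⊥ = false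
free x (φ `∧ ψ) = free x φ ∨ free x ψ
free x (`¬ φ) = free x φ
free x (`∀ z φ) = not (z == x) ∧ free x φ
free x (`E φ) = free x φ
free x (`C φ) = free x φ

sub : (y x : ℕ) → Fm → Fm
sub y x (atom n i xs) = atom n i (map (λ z → if z == x then y else z) xs)
sub y x `⊤ = `⊤
sub y x `⊥ = `⊥
sub y x (φ `∧ ψ) = sub y x φ `∧ sub y x ψ
sub y x (`¬ φ) = `¬ sub y x φ
sub y x (`∀ z φ) = if z == x then `∀ z φ else `∀ z (sub y x φ)
sub y x (`E φ) = `E (sub y x φ)
sub y x (`C φ) = `C (sub y x φ)

freeFor : (y x : ℕ) → Fm → Bool
freeFor y x (atom n i xs) = true
freeFor y x `⊤ = true
freeFor y x `⊥ = true
freeFor y x (φ `∧ ψ) = freeFor y x φ ∧ freeFor y x ψ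
freeFor y x (`¬ φ) = freeFor y x φ
freeFor y x (`∀ z φ) = not (free x (`∀ z φ)) ∨ (not (z == y) ∧ freeFor y x φ)
freeFor y x (`E φ) = freeFor y x φ
freeFor y x (`C φ) = freeFor y x φ

data QCKL⁻ : Fm → Set where
  -- classical predicate logic (a complete Hilbert calculus, all
  -- instances over the full modal language)
  ax1  : ∀ φ ψ → QCKL⁻ (φ `⊃ (ψ `⊃ φ))
  ax2  : ∀ φ ψ χ → QCKL⁻ ((φ `⊃ (ψ `⊃ χ)) `⊃ ((φ `⊃ ψ) `⊃ (φ `⊃ χ)))
  ax3  : ∀ φ ψ → QCKL⁻ ((`¬ φ `⊃ `¬ ψ) `⊃ (ψ `⊃ φ))
  ax∧₁ : ∀ φ ψ → QCKL⁻ ((φ `∧ ψ) `⊃ φ)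
  ax∧₂ : ∀ φ ψ → QCKL⁻ ((φ `∧ ψ) `⊃ ψ)
  ax∧₃ : ∀ φ ψ → QCKL⁻ (φ `⊃ (ψ `⊃ (φ `∧ ψ)))
  ax⊤  : QCKL⁻ `⊤
  ax⊥  : QCKL⁻ (`¬ `⊥)
  ax∀₁ : ∀ x y φ → T (freeFor y x φ) → QCKL⁻ (`∀ x φ `⊃ sub y x φ)
  ax∀₂ : ∀ x φ ψ → T (not (free x φ)) →
         QCKL⁻ (`∀ x (φ `⊃ ψ) `⊃ (φ `⊃ `∀ x ψ))
  axKE : ∀ φ ψ → QCKL⁻ (`E (φ `⊃ ψ) `⊃ (`E φ `⊃ `E ψ))
  axKC : ∀ φ ψ → QCKL⁻ (`C (φ `⊃ ψ) `⊃ (`C φ `⊃ `C ψ))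
  axCE : ∀ n φ → QCKL⁻ (`C φ `⊃ `Eⁿ n φ)
  mp   : ∀ {φ ψ} → QCKL⁻ (φ `⊃ ψ) → QCKL⁻ φ → QCKL⁻ ψ
  necE : ∀ {φ} → QCKL⁻ φ → QCKL⁻ (`E φ)
  necC : ∀ {φ} → QCKL⁻ φ → QCKL⁻ (`C φ)
  gen  : ∀ x {φ} → QCKL⁻ φ → QCKL⁻ (`∀ x φ)
  ω    : ∀ γ φ → (∀ n → QCKL⁻ (γ `⊃ `Eⁿ n φ)) → QCKL⁻ (γ `⊃ `C φ)

Subset : Set → Set₁
Subset C = C → Set

_⊆_ : {C : Set} → Subset C → Subset C → Set
X ⊆ Y = ∀ c → X c → Y c

record Frame : Set₁ where
  field
    C   : Set
    c₀  : C                       -- C ≠ ∅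
    𝒩E  : C → Subset C → Set
    𝒩C  : C → Subset C → Set

-- 𝒩 is upward closed and contains ⋂𝒩(c) (⋂𝒩(c) is a large predicate;
-- it belongs to 𝒩(c) iff some member of 𝒩(c) has exactly the same
-- elements)
KripkeNbhd : (C : Set) → (C → Subset C → Set) → Set₁
KripkeNbhd C 𝒩 =
  (∀ c (X Y : Subset C) → X ⊆ Y → 𝒩 c X → 𝒩 c Y) ×
  (∀ c → Σ (Subset C) λ Y → 𝒩 c Y ×
           (∀ x → (Y x → ∀ (X : Subset C) → 𝒩 c X → X x) ×
                  ((∀ (X : Subset C) → 𝒩 c X → X x) → Y x)))

IsKripke : Frame → Set₁
IsKripke Z = KripkeNbhd C 𝒩E × KripkeNbhd C 𝒩C
  where open Frame Z

module Alg (Z : Frame) where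
  open Frame Z
  E : Subset C → Subset C
  E X c = 𝒩E c X
  Cₒ : Subset C → Subset C
  Cₒ X c = 𝒩C c X
  Eⁿ : ℕ → Subset C → Subset C
  Eⁿ zero    X = X
  Eⁿ (suc n) X = E (Eⁿ n X)

module _ (Z : Frame) where
  open Frame Z
  open Alg Z

  _[_↦_] : {D : Set} → (ℕ → D) → ℕ → D → (ℕ → D)
  (A [ x ↦ d ]) z = if z == x then d else A z

  val : (D : Set) → (I : (n i : ℕ) → C → Vec D n → Set) →
        (ℕ → D) → Fm → Subset C
  val D I A (atom n i xs) c = I n i c (map A xs)
  val D I A `⊤ c = ⊤
  val D I A `⊥ c = ⊥
  val D I A (φ `∧ ψ) c = val D I A φ c × val D I A ψ c
  val D I A (`¬ φ) c = ¬ val D I A φ c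
  val D I A (`∀ x φ) c = ∀ (d : D) → val D I (A [ x ↦ d ]) φ c
  val D I A (`E φ) = E (val D I A φ)
  val D I A (`C φ) = Cₒ (val D I A φ)

  Valid : Fm → Set₁
  Valid φ = ∀ (D : Set) → D → (I : (n i : ℕ) → C → Vec D n → Set) →
            (A : ℕ → D) → ∀ (c : C) → val D I A φ c

-- In a Kripke frame E preserves arbitrary intersections, so Y = ⋂ₙ Eⁿ X
-- satisfies Y ⊆ E Y; hence p ⊃ E p is true everywhere when p denotes Y, and
-- so is C (p ⊃ E p), since every neighbourhood system contains the whole
-- space.  The induction principle  p ∧ C (p ⊃ E p) ⊃ C p, derivable with
-- the ω-rule, then gives Y ⊆ C Y ⊆ C X; the axioms C p ⊃ Eⁿ p give the
-- converse.  Finally C X = Y ⊆ E Y = E (C X).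
module Submission where

open import Defs
open import Level using (0ℓ)
open import Data.Nat using (ℕ; zero; suc)
open import Data.Product using (_×_; _,_; proj₁; proj₂)
open import Data.Unit using (⊤; tt)
open import Relation.Binary.PropositionalEquality using (_≡_; refl; cong; subst)
open import Relation.Nullary.Decidable using (decidable-stable)
open import Axiom.ExcludedMiddle using (ExcludedMiddle)

module Derivations where

  ⊢-refl : ∀ φ → QCKL⁻ (φ `⊃ φ)
  ⊢-refl φ = mp (mp (ax2 φ (φ `⊃ φ) φ) (ax1 φ (φ `⊃ φ))) (ax1 φ φ)

  ⊢-trans : ∀ {φ ψ χ} → QCKL⁻ (φ `⊃ ψ) → QCKL⁻ (ψ `⊃ χ) → QCKL⁻ (φ `⊃ χ)
  ⊢-trans {φ} {ψ} {χ} φψ ψχ = mp (mp (ax2 φ ψ χ) (mp (ax1 (ψ `⊃ χ) φ) ψχ)) φψ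

  ⊢-apply : ∀ {γ φ ψ} → QCKL⁻ (γ `⊃ (φ `⊃ ψ)) → QCKL⁻ (γ `⊃ φ) → QCKL⁻ (γ `⊃ ψ)
  ⊢-apply {γ} {φ} {ψ} γφψ γφ = mp (mp (ax2 γ φ ψ) γφψ) γφ

  Eⁿ-K : ∀ n φ ψ → QCKL⁻ (`Eⁿ n (φ `⊃ ψ) `⊃ (`Eⁿ n φ `⊃ `Eⁿ n ψ))
  Eⁿ-K zero    φ ψ = ⊢-refl (φ `⊃ ψ)
  Eⁿ-K (suc n) φ ψ =
    ⊢-trans (mp (axKE _ _) (necE (Eⁿ-K n φ ψ))) (axKE (`Eⁿ n φ) (`Eⁿ n ψ))

  Eⁿ-E : ∀ n φ → `Eⁿ n (`E φ) ≡ `Eⁿ (suc n) φ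
  Eⁿ-E zero    φ = refl
  Eⁿ-E (suc n) φ = cong `E (Eⁿ-E n φ)

  C-induction : ∀ φ → QCKL⁻ (φ `∧ `C (φ `⊃ `E φ) `⊃ `C φ)
  C-induction φ = ω hyp φ hyp⊃Eⁿ
    where
    hyp : Fm
    hyp = φ `∧ `C (φ `⊃ `E φ)

    hyp⊃Eⁿ : ∀ n → QCKL⁻ (hyp `⊃ `Eⁿ n φ)
    hyp⊃Eⁿ zero    = ax∧₁ φ (`C (φ `⊃ `E φ))
    hyp⊃Eⁿ (suc n) = subst (λ ψ → QCKL⁻ (hyp `⊃ ψ)) (Eⁿ-E n φ)
      (⊢-apply (⊢-trans (⊢-trans (ax∧₂ φ _) (axCE n (φ `⊃ `E φ)))
                        (Eⁿ-K n φ (`E φ)))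
               (hyp⊃Eⁿ n))

module KripkeNbhdProperties {C : Set} {𝒩 : C → Subset C → Set}
                            (K : KripkeNbhd C 𝒩) where

  nbhd-mono : ∀ c {X Y : Subset C} → X ⊆ Y → 𝒩 c X → 𝒩 c Y
  nbhd-mono c {X} {Y} = proj₁ K c X Y

  ⊇-⋂nbhds⇒nbhd : ∀ c {X : Subset C} →
                  (∀ x → (∀ Y → 𝒩 c Y → Y x) → X x) → 𝒩 c X
  ⊇-⋂nbhds⇒nbhd c ⋂⊆X with proj₂ K c
  ... | core , core∈𝒩 , core≐⋂ =
    nbhd-mono c (λ x x∈core → ⋂⊆X x (proj₁ (core≐⋂ x) x∈core)) core∈𝒩

  nbhd-full : ∀ c → 𝒩 c (λ _ → ⊤)
  nbhd-full c = ⊇-⋂nbhds⇒nbhd c (λ _ _ → tt)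

  nbhd-⋂ : ∀ c {I : Set} (X : I → Subset C) →
           (∀ i → 𝒩 c (X i)) → 𝒩 c (λ x → ∀ i → X i x)
  nbhd-⋂ c X X∈𝒩 = ⊇-⋂nbhds⇒nbhd c (λ x x∈⋂ i → x∈⋂ (X i) (X∈𝒩 i))

module _ (Z : Frame) where
  open Frame Z
  open Alg Z

  ⋂Eⁿ : Subset C → Subset C
  ⋂Eⁿ X c = ∀ n → Eⁿ n X c

  ⋂Eⁿ⊆E⋂Eⁿ : KripkeNbhd C 𝒩E → ∀ X → ⋂Eⁿ X ⊆ E (⋂Eⁿ X)
  ⋂Eⁿ⊆E⋂Eⁿ KE X c c∈⋂Eⁿ = nbhd-⋂ c (λ n → Eⁿ n X) (λ n → c∈⋂Eⁿ (suc n))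
    where open KripkeNbhdProperties KE

  valid-⊃⇒⊆ : ExcludedMiddle 0ℓ → ∀ {φ ψ} → Valid Z (φ `⊃ ψ) →
              ∀ D (d : D) I A → val Z D I A φ ⊆ val Z D I A ψ
  valid-⊃⇒⊆ lem ⊨φ⊃ψ D d I A c c∈φ =
    decidable-stable lem (λ c∉ψ → ⊨φ⊃ψ D d I A c (c∈φ , c∉ψ))

  ⟦_⟧ : Fm → Subset C → Subset C
  ⟦ φ ⟧ X = val Z ⊤ (λ _ _ c _ → X c) (λ _ → tt) φ

  ⟦Eⁿp⟧ : ∀ n X → ⟦ `Eⁿ n `p ⟧ X ≡ Eⁿ n X
  ⟦Eⁿp⟧ zero    X = refl
  ⟦Eⁿp⟧ (suc n) X = cong E (⟦Eⁿp⟧ n X)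

  module _ (lem : ExcludedMiddle 0ℓ) (K : IsKripke Z)
           (sound : ∀ φ → QCKL⁻ φ → Valid Z φ) where
    open Derivations
    module E-nbhd = KripkeNbhdProperties (proj₁ K)
    module C-nbhd = KripkeNbhdProperties (proj₂ K)

    ⊢⊃⇒⟦⊆⟧ : ∀ {φ ψ} → QCKL⁻ (φ `⊃ ψ) → ∀ X → ⟦ φ ⟧ X ⊆ ⟦ ψ ⟧ X
    ⊢⊃⇒⟦⊆⟧ {φ} {ψ} ⊢φ⊃ψ X =
      valid-⊃⇒⊆ lem {φ} {ψ} (sound _ ⊢φ⊃ψ) ⊤ tt (λ _ _ c _ → X c) (λ _ → tt)

    C⊆⋂Eⁿ : ∀ X → Cₒ X ⊆ ⋂Eⁿ X
    C⊆⋂Eⁿ X c c∈CX n =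
      subst (λ S → S c) (⟦Eⁿp⟧ n X) (⊢⊃⇒⟦⊆⟧ (axCE n `p) X c c∈CX)

    ⋂Eⁿ⊆C : ∀ X → ⋂Eⁿ X ⊆ Cₒ X
    ⋂Eⁿ⊆C X c c∈⋂Eⁿ =
      C-nbhd.nbhd-mono c (λ x x∈⋂Eⁿ → x∈⋂Eⁿ 0)
        (⊢⊃⇒⟦⊆⟧ (C-induction `p) (⋂Eⁿ X) c (c∈⋂Eⁿ , C[p⊃Ep]))
      where
      C[p⊃Ep] : Cₒ (⟦ `p `⊃ `E `p ⟧ (⋂Eⁿ X)) c
      C[p⊃Ep] = C-nbhd.nbhd-mono c
        (λ x _ (x∈⋂Eⁿ , x∉E⋂Eⁿ) → x∉E⋂Eⁿ (⋂Eⁿ⊆E⋂Eⁿ (proj₁ K) X x x∈⋂Eⁿ))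
        (C-nbhd.nbhd-full c)

    C⊆EC : ∀ X → Cₒ X ⊆ E (Cₒ X)
    C⊆EC X c c∈CX =
      E-nbhd.nbhd-mono c (⋂Eⁿ⊆C X) (⋂Eⁿ⊆E⋂Eⁿ (proj₁ K) X c (C⊆⋂Eⁿ X c c∈CX))

    valid-C⊃EC : Valid Z (`C `p `⊃ `E (`C `p))
    valid-C⊃EC _ _ _ _ c (c∈CX , c∉ECX) = c∉ECX (C⊆EC _ c c∈CX)

lemma7p7 : (lem : ∀ {ℓ} → ExcludedMiddle ℓ) →
    (Z : Frame) → IsKripke Z →
    (∀ φ → QCKL⁻ φ → Valid Z φ) →
    (∀ (X : Subset (Frame.C Z)) (c : Frame.C Z) →
       (Alg.Cₒ Z X c → ∀ (n : ℕ) → Alg.Eⁿ Z n X c) ×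
       ((∀ (n : ℕ) → Alg.Eⁿ Z n X c) → Alg.Cₒ Z X c))
    × Valid Z (`C `p `⊃ `E (`C `p))
lemma7p7 lem Z K sound =
  (λ X c → C⊆⋂Eⁿ Z lem K sound X c , ⋂Eⁿ⊆C Z lem K sound X c) ,
  valid-C⊃EC Z lem K sound
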